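{- Let $k<n$ be natural numbers and let $X\in\triangle_n$. Then $|\triangle_k(X)|={n \brack k}$.
   Context: $\mathbb{N}=\{1,2,3,\dots\}$ and $T_n=n(n+1)/2$ is the $n$-th triangular number, $T_0=0$. A finite set $X\subseteq\mathbb{N}$ is triangular if $|X|=T_n$ for some $n$; writing $X=\{x_1<x_2<\dots<x_{T_n}\}$, the $i$-th level of $X$ ($1\le i\le n$) is $\{x_{T_{i-1}+1},\dots,x_{T_i}\}$ (so it has $i$ elements). $\triangle_n$ denotes the set of all $X\subseteq\mathbb{N}$ with $|X|=T_n$ (triangular sets with $n$ levels). For triangular sets $X,Y$, $X\le Y$ means $X\subseteq Y$ and every level of $X$ is contained in a single level of $Y$, distinct levels of $X$ being contained in distinct levels of $Y$. For $X$ triangular, $\triangle_k(X)=\{Y\in\triangle_k: Y\le X\}$. The numbers ${n\brack k}$ are defined by ${n\brack 0}=1$, ${n\brack n}=1$, and ${n\brack k}={n-1\brack k}+\binom{n}{k}{n-1\brack k-1}$ for $0<k<n$. -}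

module Defs where

open import Data.Nat using (ℕ; zero; suc; _+_; _*_; _<_; _≤_; _≟_)
open import Data.Nat.Combinatorics using (_C_)
open import Data.Nat.Properties using ()
open import Data.List using (List; []; _∷_; length; take; drop)
open import Data.List.Relation.Unary.All using (All)
open import Data.List.Relation.Unary.Linked using (Linked)
open import Data.List.Relation.Binary.Subset.Propositional using (_⊆_)
open import Data.Vec using (Vec; []; _∷_; lookup)
open import Data.Fin using (Fin)
open import Data.Product using (Σ; _×_)
open import Function.Definitions using (Injective)
open import Relation.Binary.PropositionalEquality using (_≡_)
open import Relation.Nullary using (yes; no)

T : ℕ → ℕ
T zero    = 0
T (suc n) = T n + suc n

-- A finite subset of ℕ = {1,2,...} is represented canonically by the
-- strictly increasing list of its elements (all ≥ 1).
IsFinSet : List ℕ → Set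
IsFinSet X = Linked _<_ X × All (1 ≤_) X

IsTri : ℕ → List ℕ → Set
IsTri n X = IsFinSet X × length X ≡ T n

levelsFrom : (m : ℕ) → ℕ → List ℕ → Vec (List ℕ) m
levelsFrom zero    i xs = []
levelsFrom (suc m) i xs = take i xs ∷ levelsFrom m (suc i) (drop i xs)

-- levels n X : the n levels of X (the i-th level, 1-indexed, has i elements;
-- Fin index j corresponds to level j+1).
levels : (n : ℕ) → List ℕ → Vec (List ℕ) n
levels n X = levelsFrom n 1 X

Le : (k n : ℕ) → List ℕ → List ℕ → Set
Le k n Y X =
  (Y ⊆ X) ×
  Σ (Fin k → Fin n) (λ f →
    Injective _≡_ _≡_ f × ((i : Fin k) → lookup (levels k Y) i ⊆ lookup (levels n X) (f i)))

-- The numbers [n k]: [n 0] = 1, [n n] = 1, [n k] = [n-1 k] + C(n,k) [n-1 k-1]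
-- for 0 < k < n.  (Values for k > n are irrelevant; set to 0.)
brk : ℕ → ℕ → ℕ
brk n       zero    = 1
brk zero    (suc k) = 0
brk (suc n) (suc k) with suc k ≟ suc n
... | yes _ = 1
... | no  _ = brk n (suc k) + (suc n C suc k) * brk n k

module Submission where

-- Split X into its first n levels P and its top level Q (n+1 elements, all above P).
-- A triangular Y ≤ X with k+1 levels either avoids Q, and then Y ≤ P, or sends its
-- top level into Q. No other level of Y can go to Q: if a lower level of Y went to Q
-- while the top level went to P, the lower level would exceed the top one. In the
-- second case Y is a k-level Y′ ≤ P followed by an arbitrary (k+1)-subset of Q, and
-- conversely every such concatenation is ≤ X. So
-- |△_{k+1}(X)| = |△_{k+1}(P)| + C(n+1,k+1)·|△_k(P)|, the recursion of [n k];
-- following it, △_k(X) is enumerated explicitly as a duplicate-free list.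

open import Defs
open import Data.Nat using (ℕ; zero; suc; _+_; _*_; _∸_; _⊓_; _<_; _≤_; z≤n; s≤s; z<s; s≤s⁻¹; _<?_)
open import Data.Nat.Properties
open import Data.Nat.Combinatorics using (_C_; nCk+nC[k+1]≡[n+1]C[k+1]; nCn≡1)
open import Data.List using (List; []; _∷_; [_]; length; take; drop; _++_; map; cartesianProductWith)
open import Data.List.Properties
  using (length-++; length-map; length-take; length-drop; take++drop≡id; take-all; take-take; take-drop;
         drop-drop; ++-cancelˡ; ∷-injectiveʳ)
open import Data.List.Relation.Unary.All using (All)
import Data.List.Relation.Unary.All as All
import Data.List.Relation.Unary.All.Properties as All
open import Data.List.Relation.Unary.Any using (here; there)
import Data.List.Relation.Unary.Any.Properties as Any
open import Data.List.Relation.Unary.AllPairs using (AllPairs; []; _∷_)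
import Data.List.Relation.Unary.AllPairs.Properties as AllPairs
open import Data.List.Relation.Unary.Linked.Properties using (Linked⇒AllPairs; AllPairs⇒Linked)
open import Data.List.Relation.Unary.Unique.Propositional using (Unique)
import Data.List.Relation.Unary.Unique.Propositional.Properties as Unique
open import Data.List.Membership.Propositional using (_∈_)
open import Data.List.Membership.Propositional.Properties
  using (∈-++⁺ˡ; ∈-++⁺ʳ; ∈-++⁻; ∈-map⁺; ∈-map⁻; ∈-cartesianProductWith⁺; ∈-cartesianProductWith⁻)
open import Data.List.Relation.Binary.Subset.Propositional using (_⊆_)
open import Data.List.Relation.Binary.Subset.Propositional.Properties using (xs⊆xs++ys; xs⊆ys++xs)
open import Data.Vec using (lookup)
open import Data.Fin using (Fin; toℕ; fromℕ<)
import Data.Fin as Fin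
open import Data.Fin.Properties using (toℕ<n; toℕ-fromℕ<; toℕ-injective)
open import Data.Product using (Σ; ∃; _×_; _,_; proj₁; proj₂; uncurry)
open import Data.Product.Function.NonDependent.Propositional using (_×-⇔_)
open import Data.Sum using (_⊎_; inj₁; inj₂; [_,_]′)
open import Data.Sum.Function.Propositional using (_⊎-⇔_)
open import Data.Empty using (⊥-elim)
open import Function using (_∘_)
open import Function.Bundles using (_⇔_; mk⇔; Equivalence)
open import Function.Construct.Composition using (_⇔-∘_)
open import Function.Properties.Equivalence using () renaming (sym to ⇔-sym)
import Function.Related.Propositional as Related
open import Relation.Nullary using (yes; no; ¬_)
open import Relation.Binary.PropositionalEquality
  using (_≡_; _≢_; refl; sym; trans; cong; cong₂; subst; subst₂; module ≡-Reasoning)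

open Equivalence using (to)

private
  variable
    A : Set
    i j k m n c x y : ℕ
    xs X Y : List ℕ

take-++ : ∀ {m} (xs ys : List A) → length xs ≡ m → take m (xs ++ ys) ≡ xs
take-++ []       ys refl = refl
take-++ (x ∷ xs) ys refl = cong (x ∷_) (take-++ xs ys refl)

drop-++ : ∀ {m} (xs ys : List A) → length xs ≡ m → drop m (xs ++ ys) ≡ ys
drop-++ []       ys refl = refl
drop-++ (x ∷ xs) ys refl = drop-++ xs ys refl

take⊆ : ∀ n (xs : List A) → take n xs ⊆ xs
take⊆ n xs = subst (take n xs ⊆_) (take++drop≡id n xs) (xs⊆xs++ys _ _)

drop⊆ : ∀ n (xs : List A) → drop n xs ⊆ xs
drop⊆ n xs = subst (drop n xs ⊆_) (take++drop≡id n xs) (xs⊆ys++xs _ _)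

length-take-≤ : ∀ n (xs : List A) → length (take n xs) ≤ n
length-take-≤ n xs = subst (_≤ n) (sym (length-take n xs)) (m⊓n≤m n (length xs))

length-take-drop : ∀ m r (xs : List A) → length xs ≡ m + r →
                   length (take m xs) ≡ m × length (drop m xs) ≡ r
length-take-drop m r xs eq =
  trans (length-take m xs) (m≤n⇒m⊓n≡m (subst (m ≤_) (sym eq) (m≤m+n m r))) ,
  trans (length-drop m xs) (trans (cong (_∸ m) eq) (m+n∸m≡n m r))

take-drop-take : ∀ m n (xs : List A) → n + m ≤ c →
                 take m (drop n (take c xs)) ≡ take m (drop n xs)
take-drop-take {c = c} m n xs n+m≤c = begin
  take m (drop n (take c xs))     ≡⟨ take-drop m n (take c xs) ⟩
  drop n (take (n + m) (take c xs)) ≡⟨ cong (drop n) (take-take (n + m) c xs) ⟩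
  drop n (take ((n + m) ⊓ c) xs)  ≡⟨ cong (λ l → drop n (take l xs)) (m≤n⇒m⊓n≡m n+m≤c) ⟩
  drop n (take (n + m) xs)        ≡⟨ take-drop m n xs ⟨
  take m (drop n xs)              ∎
  where open ≡-Reasoning

length-cartesianProductWith : ∀ {A B C : Set} (f : A → B → C) xs ys →
                              length (cartesianProductWith f xs ys) ≡ length xs * length ys
length-cartesianProductWith f []       ys = refl
length-cartesianProductWith f (x ∷ xs) ys = begin
  length (map (f x) ys ++ cartesianProductWith f xs ys)         ≡⟨ length-++ (map (f x) ys) ⟩
  length (map (f x) ys) + length (cartesianProductWith f xs ys) ≡⟨ cong₂ _+_ (length-map (f x) ys)
                                                                     (length-cartesianProductWith f xs ys) ⟩
  length ys + length xs * length ys                             ∎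
  where open ≡-Reasoning

module _ (m : ℕ) {L S : List (List A)} (length-L : ∀ {a} → a ∈ L → length a ≡ m) where

  ∈-cartesian-++ : ∀ {ys} → ys ∈ cartesianProductWith _++_ L S ⇔ (take m ys ∈ L × drop m ys ∈ S)
  ∈-cartesian-++ {ys} = mk⇔ split join
    where
    split : ys ∈ cartesianProductWith _++_ L S → take m ys ∈ L × drop m ys ∈ S
    split ys∈ with ∈-cartesianProductWith⁻ _++_ L S ys∈
    ... | a , b , a∈ , b∈ , refl =
      subst (_∈ L) (sym (take-++ a b (length-L a∈))) a∈ ,
      subst (_∈ S) (sym (drop-++ a b (length-L a∈))) b∈
    join : take m ys ∈ L × drop m ys ∈ S → ys ∈ cartesianProductWith _++_ L S
    join (t∈ , d∈) = subst (_∈ _) (take++drop≡id m ys) (∈-cartesianProductWith⁺ _++_ t∈ d∈)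

cartesian-++-unique : ∀ m {L S : List (List A)} → (∀ {a} → a ∈ L → length a ≡ m) →
                      Unique L → Unique S → Unique (cartesianProductWith _++_ L S)
cartesian-++-unique m {[]}    _        _            _        = []
cartesian-++-unique m {a ∷ L} {S} length-L (a∉L ∷ unique-L) unique-S =
  Unique.++⁺ (Unique.map⁺ (++-cancelˡ a _ _) unique-S)
             (cartesian-++-unique m (length-L ∘ there) unique-L unique-S) disjoint
  where
  disjoint : ∀ {ys} → ¬ (ys ∈ map (a ++_) S × ys ∈ cartesianProductWith _++_ L S)
  disjoint (ys∈₁ , ys∈₂) with ∈-map⁻ (a ++_) ys∈₁
  ... | s , _ , refl = All.lookup a∉L
    (subst (_∈ L) (take-++ a s (length-L (here refl)))
           (proj₁ (to (∈-cartesian-++ m (length-L ∘ there)) ys∈₂)))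
    refl

Sorted : List ℕ → Set
Sorted = AllPairs _<_

take<drop : Sorted xs → x ∈ take m xs → y ∈ drop m xs → x < y
take<drop {x₀ ∷ xs} {m = suc m} (x₀<xs ∷ _) (here refl) y∈ = All.lookup x₀<xs (drop⊆ m xs y∈)
take<drop {x₀ ∷ xs} {m = suc m} (_ ∷ sorted) (there x∈) y∈ = take<drop sorted x∈ y∈

sorted-take-drop : ∀ m → Sorted (take m xs) → Sorted (drop m xs) →
                   (∀ {x y} → x ∈ take m xs → y ∈ drop m xs → x < y) → Sorted xs
sorted-take-drop {xs} m s₁ s₂ lt = subst Sorted (take++drop≡id m xs)
  (AllPairs.++⁺ s₁ s₂ (All.tabulate λ x∈ → All.tabulate λ y∈ → lt x∈ y∈))

IsCombination : ℕ → List ℕ → List ℕ → Set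
IsCombination r xs cs = Sorted cs × length cs ≡ r × cs ⊆ xs

combinations : ℕ → List A → List (List A)
combinations zero    xs       = [ [] ]
combinations (suc r) []       = []
combinations (suc r) (x ∷ xs) = map (x ∷_) (combinations r xs) ++ combinations (suc r) xs

length-combinations : ∀ r (xs : List A) → length (combinations r xs) ≡ length xs C r
length-combinations zero    xs       = refl
length-combinations (suc r) []       = refl
length-combinations (suc r) (x ∷ xs) = begin
  length (map (x ∷_) (combinations r xs) ++ combinations (suc r) xs)
    ≡⟨ length-++ (map (x ∷_) (combinations r xs)) ⟩
  length (map (x ∷_) (combinations r xs)) + length (combinations (suc r) xs)
    ≡⟨ cong₂ _+_ (trans (length-map (x ∷_) (combinations r xs)) (length-combinations r xs))
                 (length-combinations (suc r) xs) ⟩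
  length xs C r + length xs C suc r
    ≡⟨ nCk+nC[k+1]≡[n+1]C[k+1] (length xs) r ⟩
  suc (length xs) C suc r
    ∎
  where open ≡-Reasoning

combinations-sound : ∀ r xs {cs} → Sorted xs → cs ∈ combinations r xs → IsCombination r xs cs
combinations-sound zero    xs       _ (here refl) = [] , refl , λ ()
combinations-sound (suc r) (x ∷ xs) (x<xs ∷ sorted) cs∈
  with ∈-++⁻ (map (x ∷_) (combinations r xs)) cs∈
... | inj₂ cs∈′ =
  let sorted-cs , len , cs⊆ = combinations-sound (suc r) xs sorted cs∈′
  in  sorted-cs , len , there ∘ cs⊆
... | inj₁ cs∈′ with ∈-map⁻ (x ∷_) cs∈′
...   | ds , ds∈ , refl =
  let sorted-ds , len , ds⊆ = combinations-sound r xs sorted ds∈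
  in  All.tabulate (λ d∈ → All.lookup x<xs (ds⊆ d∈)) ∷ sorted-ds , cong suc len ,
      λ { (here refl) → here refl ; (there d∈) → there (ds⊆ d∈) }

combinations-complete : ∀ r xs {cs} → Sorted xs → IsCombination r xs cs → cs ∈ combinations r xs
combinations-complete zero    xs {[]} _ _ = here refl
combinations-complete (suc r) []       {c ∷ cs} _ (_ , _ , cs⊆) with cs⊆ (here refl)
... | ()
combinations-complete (suc r) (x ∷ xs) {c ∷ cs} (x<xs ∷ sorted) (c<cs ∷ sorted-cs , len , cs⊆)
  with cs⊆ (here refl)
... | here refl = ∈-++⁺ˡ (∈-map⁺ (x ∷_)
  (combinations-complete r xs sorted (sorted-cs , suc-injective len , tail⊆)))
  where
  tail⊆ : cs ⊆ xs
  tail⊆ d∈ with cs⊆ (there d∈)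
  ... | here refl = ⊥-elim (<-irrefl refl (All.lookup c<cs d∈))
  ... | there d∈xs = d∈xs
... | there c∈xs = ∈-++⁺ʳ (map (x ∷_) (combinations r xs))
  (combinations-complete (suc r) xs sorted (c<cs ∷ sorted-cs , len , cs⊆xs))
  where
  cs⊆xs : c ∷ cs ⊆ xs
  cs⊆xs (here refl) = c∈xs
  cs⊆xs (there d∈) with cs⊆ (there d∈)
  ... | here refl = ⊥-elim (<-asym (All.lookup x<xs c∈xs) (All.lookup c<cs d∈))
  ... | there d∈xs = d∈xs

∈-combinations : ∀ r xs {cs} → Sorted xs → cs ∈ combinations r xs ⇔ IsCombination r xs cs
∈-combinations r xs sorted = mk⇔ (combinations-sound r xs sorted) (combinations-complete r xs sorted)

combinations-unique : ∀ r xs → Sorted xs → Unique (combinations r xs)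
combinations-unique zero    xs       _ = All.[] ∷ []
combinations-unique (suc r) []       _ = []
combinations-unique (suc r) (x ∷ xs) (x<xs ∷ sorted) =
  Unique.++⁺ (Unique.map⁺ ∷-injectiveʳ (combinations-unique r xs sorted))
             (combinations-unique (suc r) xs sorted) disjoint
  where
  disjoint : ∀ {cs} → ¬ (cs ∈ map (x ∷_) (combinations r xs) × cs ∈ combinations (suc r) xs)
  disjoint (cs∈₁ , cs∈₂) with ∈-map⁻ (x ∷_) cs∈₁
  ... | _ , _ , refl =
    let _ , _ , cs⊆xs = combinations-sound (suc r) xs sorted cs∈₂
    in  <-irrefl refl (All.lookup x<xs (cs⊆xs (here refl)))

T-mono-≤ : m ≤ n → T m ≤ T n
T-mono-≤ z≤n     = z≤n
T-mono-≤ (s≤s p) = +-mono-≤ (T-mono-≤ p) (s≤s p)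

-- Levels are indexed from 0: level xs i is the paper's (i+1)-th level.
level : List A → ℕ → List A
level xs i = take (suc i) (drop (T i) xs)

lookup-levelsFrom : ∀ m j (xs : List ℕ) (i : Fin m) →
                    lookup (levelsFrom m (suc j) (drop (T j) xs)) i ≡ level xs (toℕ i + j)
lookup-levelsFrom (suc m) j xs Fin.zero    = refl
lookup-levelsFrom (suc m) j xs (Fin.suc i) = begin
  lookup (levelsFrom m (suc (suc j)) (drop (suc j) (drop (T j) xs))) i
    ≡⟨ cong (λ ys → lookup (levelsFrom m (suc (suc j)) ys) i) (drop-drop (T j) (suc j) xs) ⟩
  lookup (levelsFrom m (suc (suc j)) (drop (T (suc j)) xs)) i
    ≡⟨ lookup-levelsFrom m (suc j) xs i ⟩
  level xs (toℕ i + suc j)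
    ≡⟨ cong (level xs) (+-suc (toℕ i) j) ⟩
  level xs (suc (toℕ i + j))
    ∎
  where open ≡-Reasoning

lookup-levels : ∀ m (xs : List ℕ) (i : Fin m) → lookup (levels m xs) i ≡ level xs (toℕ i)
lookup-levels m xs i = trans (lookup-levelsFrom m 0 xs i) (cong (level xs) (+-identityʳ (toℕ i)))

level⊆ : ∀ (xs : List A) i → level xs i ⊆ xs
level⊆ xs i y∈ = drop⊆ (T i) xs (take⊆ (suc i) (drop (T i) xs) y∈)

level-take : ∀ (xs : List A) → T (suc i) ≤ c → level (take c xs) i ≡ level xs i
level-take {i = i} xs = take-drop-take (suc i) (T i) xs

level-last : ∀ (xs : List A) k → length xs ≤ T (suc k) → level xs k ≡ drop (T k) xs
level-last xs k len≤ = take-all (suc k) (drop (T k) xs) (begin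
  length (drop (T k) xs)   ≡⟨ length-drop (T k) xs ⟩
  length xs ∸ T k          ≤⟨ ∸-monoˡ-≤ (T k) len≤ ⟩
  T k + suc k ∸ T k        ≡⟨ m+n∸m≡n (T k) (suc k) ⟩
  suc k                    ∎)
  where open ≤-Reasoning

level-nonempty : ∀ (xs : List A) i → T (suc i) ≤ length xs → ∃ λ y → y ∈ level xs i
level-nonempty xs i len≥ with drop (T i) xs | length-drop (T i) xs
... | y ∷ _ | _  = y , here refl
... | []    | eq = ⊥-elim (<-irrefl eq (m<n⇒0<n∸m (<-≤-trans (m<m+n (T i) z<s) len≥)))

cover : ∀ k (xs : List A) {y} → length xs ≤ T k → y ∈ xs → ∃ λ i → i < k × y ∈ level xs i
cover zero    []  _    ()
cover (suc k) xs {y} len≤ y∈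
  with ∈-++⁻ (take (T k) xs) (subst (y ∈_) (sym (take++drop≡id (T k) xs)) y∈)
... | inj₁ y∈take with cover k (take (T k) xs) (length-take-≤ (T k) xs) y∈take
...   | i , i<k , y∈level = i , m<n⇒m<1+n i<k , subst (y ∈_) (level-take xs (T-mono-≤ i<k)) y∈level
cover (suc k) xs {y} len≤ y∈ | inj₂ y∈drop =
  k , ≤-refl , subst (y ∈_) (sym (level-last xs k len≤)) y∈drop

level-ordered : Sorted xs → i < j → x ∈ level xs i → y ∈ level xs j → x < y
level-ordered {xs} {i} {j} sorted i<j x∈ y∈ = take<drop sorted
  (level⊆ (take (T j) xs) i (subst (_ ∈_) (sym (level-take xs (T-mono-≤ i<j))) x∈))
  (take⊆ (suc j) (drop (T j) xs) y∈)

-- Le, with the level assignment a function on ℕ that is constrained only below k,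
-- so that it can be restricted and extended without reindexing Fin.
record LevelMap (k n : ℕ) (Y X : List ℕ) : Set where
  field
    f       : ℕ → ℕ
    f<      : i < k → f i < n
    f-inj   : i < k → j < k → f i ≡ f j → i ≡ j
    level-⊆ : i < k → level Y i ⊆ level X (f i)

open LevelMap

LevelMap⇒⊆ : length Y ≤ T k → LevelMap k n Y X → Y ⊆ X
LevelMap⇒⊆ {Y} {k} {X = X} len≤ φ y∈ with cover k Y len≤ y∈
... | i , i<k , y∈level = level⊆ X (f φ i) (level-⊆ φ i<k y∈level)

LevelMap-take : ∀ k → LevelMap (suc k) n Y X → LevelMap k n (take (T k) Y) X
LevelMap-take {Y = Y} k φ = record
  { f       = f φ
  ; f<      = λ i<k → f< φ (m<n⇒m<1+n i<k)
  ; f-inj   = λ i<k j<k → f-inj φ (m<n⇒m<1+n i<k) (m<n⇒m<1+n j<k)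
  ; level-⊆ = λ i<k → subst (_⊆ _) (sym (level-take Y (T-mono-≤ i<k))) (level-⊆ φ (m<n⇒m<1+n i<k))
  }

LevelMap-extend : ∀ k m → length Y ≤ T (suc k) → (φ : LevelMap k n (take (T k) Y) X) →
                  (∀ {i} → i < k → f φ i ≢ m) → m < n → drop (T k) Y ⊆ level X m →
                  LevelMap (suc k) n Y X
LevelMap-extend {Y} {n} {X} k m len≤ φ avoid m<n top⊆ =
  record { f = g ; f< = g< ; f-inj = g-inj ; level-⊆ = g-⊆ }
  where
  g : ℕ → ℕ
  g i with i ≟ k
  ... | yes _ = m
  ... | no  _ = f φ i

  below : i < suc k → i ≢ k → i < k
  below i<1+k i≢k = ≤∧≢⇒< (s≤s⁻¹ i<1+k) i≢k

  g< : i < suc k → g i < n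
  g< {i} i<1+k with i ≟ k
  ... | yes _   = m<n
  ... | no  i≢k = f< φ (below i<1+k i≢k)

  g-inj : i < suc k → j < suc k → g i ≡ g j → i ≡ j
  g-inj {i} {j} i< j< eq with i ≟ k | j ≟ k
  ... | yes i≡k | yes j≡k = trans i≡k (sym j≡k)
  ... | yes _   | no  j≢k = ⊥-elim (avoid (below j< j≢k) (sym eq))
  ... | no  i≢k | yes _   = ⊥-elim (avoid (below i< i≢k) eq)
  ... | no  i≢k | no  j≢k = f-inj φ (below i< i≢k) (below j< j≢k) eq

  g-⊆ : i < suc k → level Y i ⊆ level X (g i)
  g-⊆ {i} i<1+k with i ≟ k
  ... | yes refl = subst (_⊆ level X m) (sym (level-last Y k len≤)) top⊆
  ... | no  i≢k  = subst (_⊆ level X (f φ i)) (level-take Y (T-mono-≤ (below i<1+k i≢k)))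
                         (level-⊆ φ (below i<1+k i≢k))

SubTri : ℕ → ℕ → List ℕ → List ℕ → Set
SubTri k n Y X = Sorted Y × length Y ≡ T k × LevelMap k n Y X

module TopLevel (n : ℕ) (X : List ℕ) (sorted-X : Sorted X) (length-X : length X ≡ T n + suc n) where

  P Q : List ℕ
  P = take (T n) X
  Q = drop (T n) X

  length-P : length P ≡ T n
  length-P = proj₁ (length-take-drop (T n) (suc n) X length-X)

  sorted-P : Sorted P
  sorted-P = AllPairs.take⁺ (T n) sorted-X

  sorted-Q : Sorted Q
  sorted-Q = AllPairs.drop⁺ (T n) sorted-X

  P<Q : x ∈ P → y ∈ Q → x < y
  P<Q = take<drop sorted-X

  level-P : j < n → level X j ≡ level P j
  level-P j<n = sym (level-take X (T-mono-≤ j<n))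

  level-Q : level X n ≡ Q
  level-Q = level-last X n (≤-reflexive length-X)

  LevelMap-raise : LevelMap k n Y P → LevelMap k (suc n) Y X
  LevelMap-raise φ = record
    { f       = f φ
    ; f<      = m<n⇒m<1+n ∘ f< φ
    ; f-inj   = f-inj φ
    ; level-⊆ = λ i<k → subst (_ ⊆_) (sym (level-P (f< φ i<k))) (level-⊆ φ i<k)
    }

  LevelMap-lower : (φ : LevelMap k (suc n) Y X) → (∀ {i} → i < k → f φ i ≢ n) → LevelMap k n Y P
  LevelMap-lower φ avoid = record
    { f       = f φ
    ; f<      = f<′
    ; f-inj   = f-inj φ
    ; level-⊆ = λ i<k → subst (_ ⊆_) (level-P (f<′ i<k)) (level-⊆ φ i<k)
    }
    where
    f<′ : i < _ → f φ i < n
    f<′ i<k = ≤∧≢⇒< (s≤s⁻¹ (f< φ i<k)) (avoid i<k)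

  SubTri-raise : SubTri k n Y P → SubTri k (suc n) Y X
  SubTri-raise (sorted-Y , length-Y , φ) = sorted-Y , length-Y , LevelMap-raise φ

  SubTri-extend : SubTri k n (take (T k) Y) P → IsCombination (suc k) Q (drop (T k) Y) →
                  SubTri (suc k) (suc n) Y X
  SubTri-extend {k} {Y} (sorted-Y′ , length-Y′ , φ) (sorted-C , length-C , C⊆Q) =
    sorted-take-drop (T k) sorted-Y′ sorted-C Y′<C ,
    length-Y ,
    LevelMap-extend k n (≤-reflexive length-Y) (LevelMap-raise φ) (<⇒≢ ∘ f< φ) ≤-refl
                    (subst (_ ⊆_) (sym level-Q) C⊆Q)
    where
    length-Y : length Y ≡ T (suc k)
    length-Y = begin
      length Y                                    ≡⟨ cong length (take++drop≡id (T k) Y) ⟨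
      length (take (T k) Y ++ drop (T k) Y)       ≡⟨ length-++ (take (T k) Y) ⟩
      length (take (T k) Y) + length (drop (T k) Y) ≡⟨ cong₂ _+_ length-Y′ length-C ⟩
      T k + suc k                                 ∎
      where open ≡-Reasoning
    Y′<C : x ∈ take (T k) Y → y ∈ drop (T k) Y → x < y
    Y′<C x∈ y∈ = P<Q (LevelMap⇒⊆ (≤-reflexive length-Y′) φ x∈) (C⊆Q y∈)

  -- The top level of X lies above P, so it cannot host a level of Y below one hosted by P.
  top-hosts-only-top : Sorted Y → length Y ≡ T (suc k) → (φ : LevelMap (suc k) (suc n) Y X) →
                       f φ k ≢ n → i < k → f φ i ≢ n
  top-hosts-only-top {Y} {k} {i} sorted-Y length-Y φ fk≢n i<k fi≡n =
    let a , a∈ = level-nonempty Y i (subst (_ ≤_) (sym length-Y) (T-mono-≤ (m<n⇒m<1+n i<k)))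
        b , b∈ = level-nonempty Y k (≤-reflexive (sym length-Y))
    in  <-asym (level-ordered sorted-Y i<k a∈ b∈) (P<Q (level-k⊆P b∈) (level-i⊆Q a∈))
    where
    level-i⊆Q : level Y i ⊆ Q
    level-i⊆Q = subst (level Y i ⊆_) (trans (cong (level X) fi≡n) level-Q)
                      (level-⊆ φ (m<n⇒m<1+n i<k))
    level-k⊆P : level Y k ⊆ P
    level-k⊆P = level⊆ P (f φ k) ∘
      subst (level Y k ⊆_) (level-P (≤∧≢⇒< (s≤s⁻¹ (f< φ ≤-refl)) fk≢n)) (level-⊆ φ ≤-refl)

  SubTri-split : SubTri (suc k) (suc n) Y X →
                 SubTri (suc k) n Y P ⊎
                 (SubTri k n (take (T k) Y) P × IsCombination (suc k) Q (drop (T k) Y))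
  SubTri-split {k} {Y} (sorted-Y , length-Y , φ) with f φ k ≟ n
  ... | no fk≢n = inj₁ (sorted-Y , length-Y , LevelMap-lower φ avoid)
    where
    avoid : i < suc k → f φ i ≢ n
    avoid {i} i<1+k with i ≟ k
    ... | yes refl = fk≢n
    ... | no  i≢k  = top-hosts-only-top sorted-Y length-Y φ fk≢n (≤∧≢⇒< (s≤s⁻¹ i<1+k) i≢k)
  ... | yes fk≡n = inj₂
    ( (AllPairs.take⁺ (T k) sorted-Y , proj₁ lengths ,
       LevelMap-lower (LevelMap-take k φ) (λ i<k fi≡n →
         <⇒≢ i<k (f-inj φ (m<n⇒m<1+n i<k) ≤-refl (trans fi≡n (sym fk≡n)))))
    , (AllPairs.drop⁺ (T k) sorted-Y , proj₂ lengths , top⊆Q) )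
    where
    lengths : length (take (T k) Y) ≡ T k × length (drop (T k) Y) ≡ suc k
    lengths = length-take-drop (T k) (suc k) Y length-Y
    top⊆Q : drop (T k) Y ⊆ Q
    top⊆Q = subst₂ _⊆_ (level-last Y k (≤-reflexive length-Y))
                       (trans (cong (level X) fk≡n) level-Q)
                       (level-⊆ φ ≤-refl)

  SubTri-top-⇔ : SubTri (suc k) (suc n) Y X ⇔
                 (SubTri (suc k) n Y P ⊎
                  (SubTri k n (take (T k) Y) P × IsCombination (suc k) Q (drop (T k) Y)))
  SubTri-top-⇔ = mk⇔ SubTri-split [ SubTri-raise , uncurry SubTri-extend ]′

subtriangles : ℕ → ℕ → List ℕ → List (List ℕ)
subtriangles zero    n       X = [ [] ]
subtriangles (suc k) zero    X = []
subtriangles (suc k) (suc n) X =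
  subtriangles (suc k) n (take (T n) X) ++
  cartesianProductWith _++_ (subtriangles k n (take (T n) X)) (combinations (suc k) (drop (T n) X))

LevelMap-zero : LevelMap 0 n Y X
LevelMap-zero = record { f = λ _ → 0 ; f< = λ () ; f-inj = λ () ; level-⊆ = λ () }

SubTri-zero-⇔ : Y ∈ [ [] ] ⇔ SubTri 0 n Y X
SubTri-zero-⇔ = mk⇔ (λ { (here refl) → [] , refl , LevelMap-zero }) empty
  where
  empty : SubTri 0 n Y X → Y ∈ [ [] ]
  empty {Y = []} _ = here refl

¬SubTri-suc-zero : ¬ SubTri (suc k) 0 Y X
¬SubTri-suc-zero (_ , _ , φ) = n≮0 (f< φ z<s)

∈-subtriangles : ∀ k n X → Sorted X → length X ≡ T n →
                 ∀ {Y} → Y ∈ subtriangles k n X ⇔ SubTri k n Y X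
∈-subtriangles zero    n       X _ _ = SubTri-zero-⇔
∈-subtriangles (suc k) zero    X _ _ = mk⇔ (λ ()) (⊥-elim ∘ ¬SubTri-suc-zero)
∈-subtriangles (suc k) (suc n) X sorted-X length-X {Y} = begin
  Y ∈ subtriangles (suc k) (suc n) X
    ↔⟨ Any.++↔ ⟨
  (Y ∈ subtriangles (suc k) n P ⊎
   Y ∈ cartesianProductWith _++_ (subtriangles k n P) (combinations (suc k) Q))
    ∼⟨ ∈-subtriangles (suc k) n P sorted-P length-P ⊎-⇔
       (∈-subtriangles k n P sorted-P length-P ×-⇔ ∈-combinations (suc k) Q sorted-Q)
         ⇔-∘ ∈-cartesian-++ (T k) length-member ⟩
  (SubTri (suc k) n Y P ⊎
   (SubTri k n (take (T k) Y) P × IsCombination (suc k) Q (drop (T k) Y)))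
    ∼⟨ ⇔-sym SubTri-top-⇔ ⟩
  SubTri (suc k) (suc n) Y X
    ∎
  where
  open Related.EquationalReasoning
  open TopLevel n X sorted-X length-X
  length-member : ∀ {Y′} → Y′ ∈ subtriangles k n P → length Y′ ≡ T k
  length-member Y′∈ = proj₁ (proj₂ (to (∈-subtriangles k n P sorted-P length-P) Y′∈))

subtriangles-unique : ∀ k n X → Sorted X → length X ≡ T n → Unique (subtriangles k n X)
subtriangles-unique zero    n       X _ _ = All.[] ∷ []
subtriangles-unique (suc k) zero    X _ _ = []
subtriangles-unique (suc k) (suc n) X sorted-X length-X =
  Unique.++⁺ (subtriangles-unique (suc k) n P sorted-P length-P)
             (cartesian-++-unique (T k) length-member (subtriangles-unique k n P sorted-P length-P)
                                  (combinations-unique (suc k) Q sorted-Q))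
             disjoint
  where
  open TopLevel n X sorted-X length-X
  length-member : ∀ {Y} → Y ∈ subtriangles k n P → length Y ≡ T k
  length-member Y∈ = proj₁ (proj₂ (to (∈-subtriangles k n P sorted-P length-P) Y∈))
  element : ∀ {cs : List ℕ} → length cs ≡ suc k → ∃ (_∈ cs)
  element {_ ∷ _} _ = _ , here refl
  disjoint : ∀ {Y} → ¬ (Y ∈ subtriangles (suc k) n P ×
                        Y ∈ cartesianProductWith _++_ (subtriangles k n P) (combinations (suc k) Q))
  disjoint {Y} (Y∈₁ , Y∈₂) =
    let _ , length-Y , φ = to (∈-subtriangles (suc k) n P sorted-P length-P) Y∈₁
        _ , length-C , C⊆Q = combinations-sound (suc k) Q sorted-Q
                               (proj₂ (to (∈-cartesian-++ (T k) length-member) Y∈₂))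
        c , c∈ = element length-C
    in  <-irrefl refl (P<Q (LevelMap⇒⊆ (≤-reflexive length-Y) φ (drop⊆ (T k) Y c∈)) (C⊆Q c∈))

subtriangles-empty : ∀ k n X → n < k → subtriangles k n X ≡ []
subtriangles-empty (suc k) zero    X _ = refl
subtriangles-empty (suc k) (suc n) X (s≤s n<k)
  rewrite subtriangles-empty (suc k) n (take (T n) X) (m<n⇒m<1+n n<k)
        | subtriangles-empty k n (take (T n) X) n<k = refl

brk-diag : ∀ n → brk n n ≡ 1
brk-diag zero = refl
brk-diag (suc n) with suc n ≟ suc n
... | yes _   = refl
... | no  n≢n = ⊥-elim (n≢n refl)

length-subtriangles-suc : ∀ k n X → length X ≡ T n + suc n →
  length (subtriangles (suc k) (suc n) X) ≡
  length (subtriangles (suc k) n (take (T n) X)) +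
  length (subtriangles k n (take (T n) X)) * (suc n C suc k)
length-subtriangles-suc k n X length-X = begin
  length (E₁ ++ E₂)
    ≡⟨ length-++ E₁ ⟩
  length E₁ + length E₂
    ≡⟨ cong (length E₁ +_) (length-cartesianProductWith _++_ E₀ Cs) ⟩
  length E₁ + length E₀ * length Cs
    ≡⟨ cong (λ l → length E₁ + length E₀ * l) length-Cs ⟩
  length E₁ + length E₀ * (suc n C suc k)
    ∎
  where
  open ≡-Reasoning
  E₁ E₀ Cs E₂ : List (List ℕ)
  E₁ = subtriangles (suc k) n (take (T n) X)
  E₀ = subtriangles k n (take (T n) X)
  Cs = combinations (suc k) (drop (T n) X)
  E₂ = cartesianProductWith _++_ E₀ Cs
  length-Cs : length Cs ≡ suc n C suc k
  length-Cs = trans (length-combinations (suc k) (drop (T n) X))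
                    (cong (_C suc k) (proj₂ (length-take-drop (T n) (suc n) X length-X)))

length-subtriangles : ∀ k n X → k ≤ n → length X ≡ T n → length (subtriangles k n X) ≡ brk n k
length-subtriangles zero    n       X _ _ = refl
length-subtriangles (suc k) (suc n) X (s≤s k≤n) length-X with suc k ≟ suc n
... | yes refl = begin
  length (subtriangles (suc n) (suc n) X)
    ≡⟨ length-subtriangles-suc n n X length-X ⟩
  length (subtriangles (suc n) n P) + length (subtriangles n n P) * (suc n C suc n)
    ≡⟨ cong₂ (λ E b → length E + b * (suc n C suc n)) (subtriangles-empty (suc n) n P ≤-refl)
             (length-subtriangles n n P ≤-refl length-P) ⟩
  brk n n * (suc n C suc n)
    ≡⟨ cong₂ _*_ (brk-diag n) (nCn≡1 (suc n)) ⟩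
  1
    ∎
  where
  open ≡-Reasoning
  P : List ℕ
  P = take (T n) X
  length-P : length P ≡ T n
  length-P = proj₁ (length-take-drop (T n) (suc n) X length-X)
... | no  k≢n  = begin
  length (subtriangles (suc k) (suc n) X)
    ≡⟨ length-subtriangles-suc k n X length-X ⟩
  length (subtriangles (suc k) n P) + length (subtriangles k n P) * (suc n C suc k)
    ≡⟨ cong₂ (λ a b → a + b * (suc n C suc k))
             (length-subtriangles (suc k) n P (≤∧≢⇒< k≤n (k≢n ∘ cong suc)) length-P)
             (length-subtriangles k n P k≤n length-P) ⟩
  brk n (suc k) + brk n k * (suc n C suc k)
    ≡⟨ cong (brk n (suc k) +_) (*-comm (brk n k) _) ⟩
  brk n (suc k) + (suc n C suc k) * brk n k
    ∎
  where
  open ≡-Reasoning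
  P : List ℕ
  P = take (T n) X
  length-P : length P ≡ T n
  length-P = proj₁ (length-take-drop (T n) (suc n) X length-X)

extendℕ : (Fin k → ℕ) → ℕ → ℕ
extendℕ {k} h i with i <? k
... | yes i<k = h (fromℕ< i<k)
... | no  _   = 0

extendℕ-< : (h : Fin k → ℕ) → (i<k : i < k) → extendℕ h i ≡ h (fromℕ< i<k)
extendℕ-< {k} {i} h i<k with i <? k
... | yes _   = refl
... | no  i≮k = ⊥-elim (i≮k i<k)

Le⇒LevelMap : Le k n Y X → LevelMap k n Y X
Le⇒LevelMap {k} {n} {Y} {X} (_ , g , g-inj , g-⊆) = record
  { f       = extendℕ (toℕ ∘ g)
  ; f<      = λ i<k → subst (_< n) (sym (extendℕ-< (toℕ ∘ g) i<k)) (toℕ<n _)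
  ; f-inj   = λ {i} {j} i<k j<k eq → begin
      i                                ≡⟨ toℕ-fromℕ< i<k ⟨
      toℕ (fromℕ< i<k)                 ≡⟨ cong toℕ (g-inj (toℕ-injective (begin
        toℕ (g (fromℕ< i<k))             ≡⟨ extendℕ-< (toℕ ∘ g) i<k ⟨
        extendℕ (toℕ ∘ g) i              ≡⟨ eq ⟩
        extendℕ (toℕ ∘ g) j              ≡⟨ extendℕ-< (toℕ ∘ g) j<k ⟩
        toℕ (g (fromℕ< j<k))             ∎))) ⟩
      toℕ (fromℕ< j<k)                 ≡⟨ toℕ-fromℕ< j<k ⟩
      j                                ∎
  ; level-⊆ = λ {i} i<k → subst₂ _⊆_
      (trans (lookup-levels k Y (fromℕ< i<k)) (cong (level Y) (toℕ-fromℕ< i<k)))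
      (trans (lookup-levels n X (g (fromℕ< i<k))) (cong (level X) (sym (extendℕ-< (toℕ ∘ g) i<k))))
      (g-⊆ (fromℕ< i<k))
  }
  where open ≡-Reasoning

LevelMap⇒Le : length Y ≤ T k → LevelMap k n Y X → Le k n Y X
LevelMap⇒Le {Y} {k} {n} {X} length-Y φ = LevelMap⇒⊆ length-Y φ , g , g-inj , g-⊆
  where
  g : Fin k → Fin n
  g i = fromℕ< (f< φ (toℕ<n i))
  toℕ-g : ∀ i → toℕ (g i) ≡ f φ (toℕ i)
  toℕ-g i = toℕ-fromℕ< (f< φ (toℕ<n i))
  g-inj : ∀ {i j} → g i ≡ g j → i ≡ j
  g-inj {i} {j} eq = toℕ-injective
    (f-inj φ (toℕ<n i) (toℕ<n j) (trans (sym (toℕ-g i)) (trans (cong toℕ eq) (toℕ-g j))))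
  g-⊆ : ∀ i → lookup (levels k Y) i ⊆ lookup (levels n X) (g i)
  g-⊆ i = subst₂ _⊆_ (sym (lookup-levels k Y i))
                     (trans (cong (level X) (sym (toℕ-g i))) (sym (lookup-levels n X (g i))))
                     (level-⊆ φ (toℕ<n i))

IsTri×Le⇔SubTri : All (1 ≤_) X → (IsTri k Y × Le k n Y X) ⇔ SubTri k n Y X
IsTri×Le⇔SubTri positive = mk⇔
  (λ { (((linked , _) , length-Y) , le) → Linked⇒AllPairs <-trans linked , length-Y , Le⇒LevelMap le })
  (λ { (sorted , length-Y , φ) →
       let Y⊆X = LevelMap⇒⊆ (≤-reflexive length-Y) φ
       in  ((AllPairs⇒Linked sorted , All.anti-mono Y⊆X positive) , length-Y) ,
           LevelMap⇒Le (≤-reflexive length-Y) φ })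

theorem1 : (k n : ℕ) → k < n → (X : List ℕ) → IsTri n X →
    Σ (List (List ℕ)) (λ L →
      Unique L × ((Y : List ℕ) → (Y ∈ L) ⇔ (IsTri k Y × Le k n Y X)) × length L ≡ brk n k)
theorem1 k n k<n X ((linked , positive) , length-X) =
  subtriangles k n X ,
  subtriangles-unique k n X sorted length-X ,
  (λ Y → ⇔-sym (IsTri×Le⇔SubTri positive) ⇔-∘ ∈-subtriangles k n X sorted length-X) ,
  length-subtriangles k n X (<⇒≤ k<n) length-X
  where
  sorted : Sorted X
  sorted = Linked⇒AllPairs <-trans linked
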